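{- Let $n\geq 3$ and let $\mathscr{D}=(d_1,\dots,d_n)$ be a sequence of positive integers with $d_n>d_{n-1}>\dots>d_2>d_1$. Consider all caterpillar trees whose path (backbone) vertices, in some order along the path, have the degrees $d_1,\dots,d_n$. Then the caterpillar tree in which these path vertices appear along the path in the order $d_1,d_2,\dots,d_n$ has the minimum value of the Albertson index $\operatorname{irr}$ among all these caterpillar trees.
   Context: For a graph $G$ with vertex degrees $d_u$, the Albertson (irregularity) index is $\operatorname{irr}(G)=\sum_{uv\in E(G)}|d_u-d_v|$. A caterpillar tree is a tree such that deleting all its leaves yields a path; the vertices of that path are the path (backbone) vertices, and the remaining vertices are pendant vertices attached to them. -}

module Defs where

open import Data.Nat using (ℕ; zero; suc; _+_; _∸_; _<_; _<?_; ∣_-_∣)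
open import Data.Fin using (Fin; toℕ; fromℕ<)
import Data.Fin as Fin
open import Data.List using (List; []; _∷_; [_]; map; concatMap; upTo; allFin)
open import Data.Nat.ListAction using (sum)
open import Data.Product using (_×_; _,_)
open import Data.Bool using (if_then_else_)
open import Relation.Nullary using (yes; no; Dec)
open import Relation.Nullary.Decidable using (⌊_⌋)
open import Relation.Binary.PropositionalEquality using (_≡_; refl; cong; cong₂)
import Data.Nat as ℕ

-- Vertices of a caterpillar with n backbone vertices:
--   bb i    : the i-th backbone (path) vertex, in path order
--   pd i j  : the j-th pendant vertex attached to backbone vertex i
data V (n : ℕ) : Set where
  bb : Fin n → V n
  pd : Fin n → ℕ → V n

_≟V_ : ∀ {n} → (u v : V n) → Dec (u ≡ v)
bb i ≟V bb j with i Fin.≟ j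
... | yes refl = yes refl
... | no ¬p = no λ { refl → ¬p refl }
bb i ≟V pd j k = no λ ()
pd i k ≟V bb j = no λ ()
pd i k ≟V pd j l with i Fin.≟ j | k ℕ.≟ l
... | yes refl | yes refl = yes refl
... | no ¬p | _ = no λ { refl → ¬p refl }
... | yes _ | no ¬q = no λ { refl → ¬q refl }

Graph : ℕ → Set
Graph n = List (V n × V n)

incid : ∀ {n} → V n × V n → V n → ℕ
incid (x , y) v = (if ⌊ x ≟V v ⌋ then 1 else 0) + (if ⌊ y ≟V v ⌋ then 1 else 0)

deg : ∀ {n} → Graph n → V n → ℕ
deg G v = sum (map (λ e → incid e v) G)

irr : ∀ {n} → Graph n → ℕ
irr G = sum (map (λ { (u , v) → ∣ deg G u - deg G v ∣ }) G)

backboneNbrs : (n : ℕ) → Fin n → ℕ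
backboneNbrs n i =
  (if toℕ i ℕ.≡ᵇ 0 then 0 else 1) + (if suc (toℕ i) ℕ.≡ᵇ n then 0 else 1)

pathEdgeFrom : ∀ {n} → Fin n → Graph n
pathEdgeFrom {n} i with suc (toℕ i) <? n
... | yes p = [ (bb i , bb (fromℕ< p)) ]
... | no _ = []

pathEdges : (n : ℕ) → Graph n
pathEdges n = concatMap pathEdgeFrom (allFin n)

-- pendant edges: backbone vertex i receives (a i − #backbone neighbours) pendant leaves,
-- so that its degree in the caterpillar is a i
pendantEdges : (n : ℕ) → (Fin n → ℕ) → Graph n
pendantEdges n a =
  concatMap (λ i → map (λ j → (bb i , pd i j)) (upTo (a i ∸ backboneNbrs n i))) (allFin n)

caterpillar : (n : ℕ) → (Fin n → ℕ) → Graph n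
caterpillar n a = pathEdges n Data.List.++ pendantEdges n a

{-# OPTIONS --safe #-}
module Submission where

open import Defs
open import Data.Nat using (ℕ; _≤_; _<_)
open import Data.Fin using (Fin)
import Data.Fin as Fin
open import Data.Fin.Permutation using (Permutation′; _⟨$⟩ʳ_)

open import Data.Bool using (Bool; true; false; if_then_else_; _∧_)
open import Data.Fin using (zero; suc; toℕ; fromℕ; inject₁)
import Data.Fin.Properties as Finₚ
open import Data.Fin.Permutation using (_⟨$⟩ˡ_; inverseʳ)
open import Data.List using (List; []; _∷_; [_]; _++_; map; concatMap; applyUpTo; upTo; tabulate; allFin)
import Data.List.Properties as Listₚ
import Data.Nat as ℕ
open import Data.Nat using (zero; suc; _+_; _*_; _∸_; ∣_-_∣; _≡ᵇ_; z≤n; s≤s; z<s; s<s)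
open import Data.Nat.ListAction using (sum)
open import Data.Nat.ListAction.Properties using (sum-++)
open import Data.Nat.Properties
open import Algebra.Properties.CommutativeMonoid.Sum +-0-commutativeMonoid
  using (sum-syntax; sum-cong-≗; sum-replicate-zero; sum-init-last; ∑-distrib-+; sum-permute)
open import Algebra.Properties.CommutativeSemigroup +-commutativeSemigroup using (interchange)
open import Data.Nat.Tactic.RingSolver using (solve-∀)
open import Data.Product using (_×_; _,_)
open import Function using (_∘_; id; mk⇔)
open import Relation.Nullary using (Dec; contradiction)
open import Relation.Nullary.Decidable using (⌊_⌋; does; yes; no; _×-dec_; isYes≗does; does-⇔)
open import Relation.Binary.PropositionalEquality
  using (_≡_; refl; sym; trans; cong; cong₂; subst; module ≡-Reasoning)

-- Write a for the backbone degrees in path order, b i for the number of backbone neighbours of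
-- vertex i and e i = a i − 1.  Vertex i carries a i − b i leaves, each edge to a leaf contributing
-- e i, and Σ b i e i = 2 Σ e i − e first − e last because every inner vertex has two backbone
-- neighbours.  Hence irr + 2 (1 + Σ e i) = (a first + Σ ∣a i − a (i+1)∣ + a last) + Σ a i e i: apart
-- from the bracket, the total variation of the sequence 0, a, 0, both sides only depend on the
-- multiset of degrees.  That variation is at least twice the maximal degree, since the sequence has to
-- climb from 0 to the maximum and back, with equality when a is increasing.

sum-map-++ : ∀ {A : Set} (f : A → ℕ) xs ys → sum (map f (xs ++ ys)) ≡ sum (map f xs) + sum (map f ys)
sum-map-++ f xs ys = trans (cong sum (Listₚ.map-++ f xs ys)) (sum-++ (map f xs) (map f ys))

sum-map-concatMap : ∀ {A B : Set} (f : B → ℕ) (g : A → List B) xs →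
                    sum (map f (concatMap g xs)) ≡ sum (map (sum ∘ map f ∘ g) xs)
sum-map-concatMap f g []       = refl
sum-map-concatMap f g (x ∷ xs) =
  trans (sum-map-++ f (g x) (concatMap g xs)) (cong (sum (map f (g x)) +_) (sum-map-concatMap f g xs))

sum-tabulate : ∀ {n} (f : Fin n → ℕ) → sum (tabulate f) ≡ ∑[ i < n ] f i
sum-tabulate {zero}  f = refl
sum-tabulate {suc n} f = cong (f zero +_) (sum-tabulate (f ∘ suc))

sum-map-allFin : ∀ {n} (f : Fin n → ℕ) → sum (map f (allFin n)) ≡ ∑[ i < n ] f i
sum-map-allFin f = trans (cong sum (Listₚ.map-tabulate id f)) (sum-tabulate f)

sum-applyUpTo : ∀ (f : ℕ → ℕ) k → sum (applyUpTo f k) ≡ ∑[ j < k ] f (toℕ j)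
sum-applyUpTo f zero    = refl
sum-applyUpTo f (suc k) = cong (f 0 +_) (sum-applyUpTo (f ∘ suc) k)

sum-map-upTo : ∀ (f : ℕ → ℕ) k → sum (map f (upTo k)) ≡ ∑[ j < k ] f (toℕ j)
sum-map-upTo f k = trans (cong sum (Listₚ.map-upTo f k)) (sum-applyUpTo f k)

∑-const : ∀ n c → ∑[ k < n ] c ≡ n * c
∑-const zero    c = refl
∑-const (suc n) c = cong (c +_) (∑-const n c)

-- ⌊_⌋ is isYes, which does not compute through the map′ in Fin's _≟_ (⌊ suc k ≟ suc i ⌋ is stuck),
-- whereas does (suc k ≟ suc i) reduces to does (k ≟ i); so indicators are built on does.
𝟙 : ∀ {p} {P : Set p} → Dec P → ℕ
𝟙 P? = if does P? then 1 else 0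

∑-select : ∀ {n} (f : Fin n → ℕ) (i : Fin n) →
           ∑[ k < n ] (if does (k Fin.≟ i) then f k else 0) ≡ f i
∑-select {suc n} f zero    = trans (cong (f zero +_) (sum-replicate-zero n)) (+-identityʳ (f zero))
∑-select {suc n} f (suc i) = ∑-select (f ∘ suc) i

∑-indicator : ∀ {n} (i : Fin n) → ∑[ k < n ] 𝟙 (k Fin.≟ i) ≡ 1
∑-indicator = ∑-select (λ _ → 1)

∑-𝟙-toℕ≟ : ∀ {k j} → j < k → ∑[ l < k ] 𝟙 (toℕ l ℕ.≟ j) ≡ 1
∑-𝟙-toℕ≟ {suc k} {zero}  _         = cong suc (sum-replicate-zero k)
∑-𝟙-toℕ≟ {suc k} {suc j} (s<s j<k) = ∑-𝟙-toℕ≟ j<k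

∑-if-∧ : ∀ {n} b (c : Fin n → Bool) →
         ∑[ k < n ] (if b ∧ c k then 1 else 0) ≡ (if b then ∑[ k < n ] (if c k then 1 else 0) else 0)
∑-if-∧ {n} false c = sum-replicate-zero n
∑-if-∧     true  c = refl

bb-injective : ∀ {n} {i j : Fin n} → bb i ≡ bb j → i ≡ j
bb-injective refl = refl

pd-injective : ∀ {n} {i j : Fin n} {k l : ℕ} → pd i k ≡ pd j l → i ≡ j × k ≡ l
pd-injective refl = refl , refl

⌊bb≟bb⌋ : ∀ {n} (i j : Fin n) → ⌊ bb i ≟V bb j ⌋ ≡ does (i Fin.≟ j)
⌊bb≟bb⌋ i j = trans (isYes≗does (bb i ≟V bb j)) (does-⇔ (mk⇔ bb-injective (cong bb)) (bb i ≟V bb j) (i Fin.≟ j))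

⌊pd≟pd⌋ : ∀ {n} (i j : Fin n) (k l : ℕ) → ⌊ pd i k ≟V pd j l ⌋ ≡ does (i Fin.≟ j) ∧ does (k ℕ.≟ l)
⌊pd≟pd⌋ i j k l = trans (isYes≗does (pd i k ≟V pd j l))
  (does-⇔ (mk⇔ pd-injective (λ { (refl , refl) → refl })) (pd i k ≟V pd j l) ((i Fin.≟ j) ×-dec (k ℕ.≟ l)))

incid-bb : ∀ {n} (x y i : Fin n) → incid (bb x , bb y) (bb i) ≡ 𝟙 (x Fin.≟ i) + 𝟙 (y Fin.≟ i)
incid-bb x y i = cong₂ _+_ (cong bool→ℕ (⌊bb≟bb⌋ x i)) (cong bool→ℕ (⌊bb≟bb⌋ y i))
  where
  bool→ℕ : Bool → ℕ
  bool→ℕ b = if b then 1 else 0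

leftNbrs : ∀ {n} → Fin n → ℕ
leftNbrs i = if toℕ i ≡ᵇ 0 then 0 else 1

rightNbrs : (n : ℕ) → Fin n → ℕ
rightNbrs n i = if suc (toℕ i) ≡ᵇ n then 0 else 1

if-0-1≤1 : ∀ b → (if b then 0 else 1) ≤ 1
if-0-1≤1 false = ≤-refl
if-0-1≤1 true  = z≤n

increasing⇒nbrs≤ : ∀ {n} (d : Fin n → ℕ) → (∀ i → 0 < d i) → (∀ i j → i Fin.< j → d i < d j) →
                   ∀ i → backboneNbrs n i ≤ d i
increasing⇒nbrs≤ d 0<d d↑ zero    = ≤-trans (if-0-1≤1 _) (0<d zero)
increasing⇒nbrs≤ d 0<d d↑ (suc i) =
  ≤-trans (s≤s (if-0-1≤1 _)) (≤-trans (s≤s (0<d zero)) (d↑ zero (suc i) z<s))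

∑-𝟙-suc≟ : ∀ {n} (i : Fin (suc n)) → ∑[ k < n ] 𝟙 (suc k Fin.≟ i) ≡ leftNbrs i
∑-𝟙-suc≟ {n} zero    = sum-replicate-zero n
∑-𝟙-suc≟     (suc i) = ∑-indicator i

∑-𝟙-inject₁≟ : ∀ {n} (i : Fin (suc n)) → ∑[ k < n ] 𝟙 (inject₁ k Fin.≟ i) ≡ rightNbrs (suc n) i
∑-𝟙-inject₁≟ {zero}  zero    = refl
∑-𝟙-inject₁≟ {suc n} zero    = cong suc (sum-replicate-zero n)
∑-𝟙-inject₁≟ {suc n} (suc i) = ∑-𝟙-inject₁≟ i

∑-leftNbrs : ∀ {n} (x : Fin (suc n) → ℕ) → ∑[ i < suc n ] (leftNbrs i * x i) + x zero ≡ ∑[ i < suc n ] x i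
∑-leftNbrs x = trans (cong (_+ x zero) (sum-cong-≗ (λ k → *-identityˡ (x (suc k))))) (+-comm _ (x zero))

∑-rightNbrs : ∀ {n} (x : Fin (suc n) → ℕ) → ∑[ i < suc n ] (rightNbrs (suc n) i * x i) + x (fromℕ n) ≡ ∑[ i < suc n ] x i
∑-rightNbrs {zero}  x = sym (+-identityʳ (x zero))
∑-rightNbrs {suc n} x = begin
  x zero + 0 + rest + x (fromℕ (suc n))   ≡⟨ cong (λ t → t + rest + x (fromℕ (suc n))) (+-identityʳ (x zero)) ⟩
  x zero + rest + x (fromℕ (suc n))       ≡⟨ +-assoc (x zero) rest (x (fromℕ (suc n))) ⟩
  x zero + (rest + x (fromℕ (suc n)))     ≡⟨ cong (x zero +_) (∑-rightNbrs (x ∘ suc)) ⟩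
  x zero + ∑[ k < suc n ] x (suc k)       ∎
  where
  open ≡-Reasoning
  rest : ℕ
  rest = ∑[ k < suc n ] (rightNbrs (suc n) k * x (suc k))

∑-backboneNbrs : ∀ {n} (x : Fin (suc n) → ℕ) →
                 ∑[ i < suc n ] (backboneNbrs (suc n) i * x i) + x zero + x (fromℕ n) ≡ ∑[ i < suc n ] x i + ∑[ i < suc n ] x i
∑-backboneNbrs {n} x = begin
  ∑[ i < suc n ] (backboneNbrs (suc n) i * x i) + x zero + x (fromℕ n)
    ≡⟨ cong (λ t → t + x zero + x (fromℕ n)) (trans (sum-cong-≗ split) (∑-distrib-+ left right)) ⟩
  ∑[ i < suc n ] left i + ∑[ i < suc n ] right i + x zero + x (fromℕ n)
    ≡⟨ trans (+-assoc _ (x zero) (x (fromℕ n))) (interchange (∑[ i < suc n ] left i) _ (x zero) (x (fromℕ n))) ⟩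
  (∑[ i < suc n ] left i + x zero) + (∑[ i < suc n ] right i + x (fromℕ n))
    ≡⟨ cong₂ _+_ (∑-leftNbrs x) (∑-rightNbrs x) ⟩
  ∑[ i < suc n ] x i + ∑[ i < suc n ] x i  ∎
  where
  open ≡-Reasoning
  left right : Fin (suc n) → ℕ
  left i = leftNbrs i * x i
  right i = rightNbrs (suc n) i * x i
  split : ∀ i → backboneNbrs (suc n) i * x i ≡ left i + right i
  split i = *-distribʳ-+ (x i) (leftNbrs i) (rightNbrs (suc n) i)

pathEdgeFrom-inject₁ : ∀ {n} (k : Fin n) → pathEdgeFrom (inject₁ k) ≡ [ (bb (inject₁ k) , bb (suc k)) ]
pathEdgeFrom-inject₁ {n} k with suc (toℕ (inject₁ k)) <? suc n
... | yes p = cong (λ j → [ (bb (inject₁ k) , bb j) ])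
                   (Finₚ.toℕ-injective (trans (Finₚ.toℕ-fromℕ< p) (cong suc (Finₚ.toℕ-inject₁ k))))
... | no ¬p = contradiction (s<s (subst (_< n) (sym (Finₚ.toℕ-inject₁ k)) (Finₚ.toℕ<n k))) ¬p

pathEdgeFrom-fromℕ : ∀ n → pathEdgeFrom (fromℕ n) ≡ []
pathEdgeFrom-fromℕ n with suc (toℕ (fromℕ n)) <? suc n
... | yes p = contradiction (cong suc (Finₚ.toℕ-fromℕ n)) (<⇒≢ p)
... | no _  = refl

sum-pathEdges : ∀ {n} (w : V (suc n) × V (suc n) → ℕ) →
                sum (map w (pathEdges (suc n))) ≡ ∑[ k < n ] w (bb (inject₁ k) , bb (suc k))
sum-pathEdges {n} w = begin
  sum (map w (pathEdges (suc n)))                                  ≡⟨ sum-map-concatMap w pathEdgeFrom (allFin (suc n)) ⟩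
  sum (map (weight ∘ pathEdgeFrom) (allFin (suc n)))               ≡⟨ sum-map-allFin (weight ∘ pathEdgeFrom) ⟩
  ∑[ k < suc n ] weight (pathEdgeFrom k)                           ≡⟨ sum-init-last (weight ∘ pathEdgeFrom) ⟩
  ∑[ k < n ] weight (pathEdgeFrom (inject₁ k)) + weight (pathEdgeFrom (fromℕ n))
    ≡⟨ cong₂ _+_ (sum-cong-≗ (λ k → trans (cong weight (pathEdgeFrom-inject₁ k)) (+-identityʳ _)))
                 (cong weight (pathEdgeFrom-fromℕ n)) ⟩
  ∑[ k < n ] w (bb (inject₁ k) , bb (suc k)) + 0                    ≡⟨ +-identityʳ _ ⟩
  ∑[ k < n ] w (bb (inject₁ k) , bb (suc k))                        ∎
  where
  open ≡-Reasoning
  weight : List (V (suc n) × V (suc n)) → ℕ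
  weight = sum ∘ map w

pendants : (n : ℕ) → (Fin n → ℕ) → Fin n → ℕ
pendants n a i = a i ∸ backboneNbrs n i

sum-pendantEdges : ∀ {n} (a : Fin n → ℕ) (w : V n × V n → ℕ) →
                   sum (map w (pendantEdges n a)) ≡ ∑[ i < n ] ∑[ j < pendants n a i ] w (bb i , pd i (toℕ j))
sum-pendantEdges {n} a w =
  trans (sum-map-concatMap w leaves (allFin n)) (trans (sum-map-allFin (sum ∘ map w ∘ leaves)) (sum-cong-≗ leaves-weight))
  where
  leaves : Fin n → List (V n × V n)
  leaves i = map (λ j → (bb i , pd i j)) (upTo (pendants n a i))
  leaves-weight : ∀ i → sum (map w (leaves i)) ≡ ∑[ j < pendants n a i ] w (bb i , pd i (toℕ j))
  leaves-weight i = trans (cong sum (sym (Listₚ.map-∘ (upTo (pendants n a i)))))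
                          (sum-map-upTo (λ j → w (bb i , pd i j)) (pendants n a i))

deg-++ : ∀ {n} (G H : Graph n) v → deg (G ++ H) v ≡ deg G v + deg H v
deg-++ G H v = sum-map-++ (λ e → incid e v) G H

deg-pathEdges-bb : ∀ {n} (i : Fin (suc n)) → deg (pathEdges (suc n)) (bb i) ≡ backboneNbrs (suc n) i
deg-pathEdges-bb {n} i = begin
  deg (pathEdges (suc n)) (bb i)                               ≡⟨ sum-pathEdges (λ e → incid e (bb i)) ⟩
  ∑[ k < n ] incid (bb (inject₁ k) , bb (suc k)) (bb i)         ≡⟨ sum-cong-≗ (λ k → incid-bb (inject₁ k) (suc k) i) ⟩
  ∑[ k < n ] (𝟙 (inject₁ k Fin.≟ i) + 𝟙 (suc k Fin.≟ i))        ≡⟨ ∑-distrib-+ (λ k → 𝟙 (inject₁ k Fin.≟ i)) (λ k → 𝟙 (suc k Fin.≟ i)) ⟩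
  ∑[ k < n ] 𝟙 (inject₁ k Fin.≟ i) + ∑[ k < n ] 𝟙 (suc k Fin.≟ i) ≡⟨ cong₂ _+_ (∑-𝟙-inject₁≟ i) (∑-𝟙-suc≟ i) ⟩
  rightNbrs (suc n) i + leftNbrs i                             ≡⟨ +-comm (rightNbrs (suc n) i) (leftNbrs i) ⟩
  backboneNbrs (suc n) i                                       ∎
  where open ≡-Reasoning

deg-pathEdges-pd : ∀ {n} (i : Fin (suc n)) j → deg (pathEdges (suc n)) (pd i j) ≡ 0
deg-pathEdges-pd {n} i j = trans (sum-pathEdges (λ e → incid e (pd i j))) (sum-replicate-zero n)

deg-pendantEdges-bb : ∀ {n} (a : Fin n → ℕ) i → deg (pendantEdges n a) (bb i) ≡ pendants n a i
deg-pendantEdges-bb {n} a i = begin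
  deg (pendantEdges n a) (bb i)                                           ≡⟨ sum-pendantEdges a (λ e → incid e (bb i)) ⟩
  ∑[ i′ < n ] ∑[ j < pendants n a i′ ] incid (bb i′ , pd i′ (toℕ j)) (bb i)  ≡⟨ sum-cong-≗ leaves ⟩
  ∑[ i′ < n ] (if does (i′ Fin.≟ i) then pendants n a i′ else 0)           ≡⟨ ∑-select (pendants n a) i ⟩
  pendants n a i                                                          ∎
  where
  open ≡-Reasoning
  leaves : ∀ i′ → ∑[ j < pendants n a i′ ] incid (bb i′ , pd i′ (toℕ j)) (bb i)
                  ≡ (if does (i′ Fin.≟ i) then pendants n a i′ else 0)
  leaves i′ = trans (∑-const (pendants n a i′) _) (lemma (⌊ bb i′ ≟V bb i ⌋) (does (i′ Fin.≟ i)) (⌊bb≟bb⌋ i′ i))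
    where
    lemma : ∀ b c → b ≡ c → pendants n a i′ * ((if b then 1 else 0) + 0) ≡ (if c then pendants n a i′ else 0)
    lemma false .false refl = *-zeroʳ (pendants n a i′)
    lemma true  .true  refl = *-identityʳ (pendants n a i′)

deg-pendantEdges-pd : ∀ {n} (a : Fin n → ℕ) i j → j < pendants n a i → deg (pendantEdges n a) (pd i j) ≡ 1
deg-pendantEdges-pd {n} a i j j<p = begin
  deg (pendantEdges n a) (pd i j)                                        ≡⟨ sum-pendantEdges a (λ e → incid e (pd i j)) ⟩
  ∑[ i′ < n ] ∑[ l < pendants n a i′ ] incid (bb i′ , pd i′ (toℕ l)) (pd i j) ≡⟨ sum-cong-≗ leaves ⟩
  ∑[ i′ < n ] (if does (i′ Fin.≟ i) then ∑[ l < pendants n a i′ ] 𝟙 (toℕ l ℕ.≟ j) else 0)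
                                                                         ≡⟨ ∑-select (λ i′ → ∑[ l < pendants n a i′ ] 𝟙 (toℕ l ℕ.≟ j)) i ⟩
  ∑[ l < pendants n a i ] 𝟙 (toℕ l ℕ.≟ j)                                 ≡⟨ ∑-𝟙-toℕ≟ j<p ⟩
  1                                                                      ∎
  where
  open ≡-Reasoning
  leaves : ∀ i′ → ∑[ l < pendants n a i′ ] incid (bb i′ , pd i′ (toℕ l)) (pd i j)
                  ≡ (if does (i′ Fin.≟ i) then ∑[ l < pendants n a i′ ] 𝟙 (toℕ l ℕ.≟ j) else 0)
  leaves i′ = trans (sum-cong-≗ {pendants n a i′} (λ l → cong (λ b → if b then 1 else 0) (⌊pd≟pd⌋ i′ i (toℕ l) j)))
                    (∑-if-∧ {pendants n a i′} (does (i′ Fin.≟ i)) (λ l → does (toℕ l ℕ.≟ j)))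

deg-caterpillar-bb : ∀ {n} (a : Fin (suc n) → ℕ) → (∀ i → backboneNbrs (suc n) i ≤ a i) →
                     ∀ i → deg (caterpillar (suc n) a) (bb i) ≡ a i
deg-caterpillar-bb {n} a nbrs≤a i = begin
  deg (caterpillar (suc n) a) (bb i)                                   ≡⟨ deg-++ (pathEdges (suc n)) (pendantEdges (suc n) a) (bb i) ⟩
  deg (pathEdges (suc n)) (bb i) + deg (pendantEdges (suc n) a) (bb i) ≡⟨ cong₂ _+_ (deg-pathEdges-bb i) (deg-pendantEdges-bb a i) ⟩
  backboneNbrs (suc n) i + (a i ∸ backboneNbrs (suc n) i)              ≡⟨ m+[n∸m]≡n (nbrs≤a i) ⟩
  a i                                                                  ∎
  where open ≡-Reasoning

deg-caterpillar-pd : ∀ {n} (a : Fin (suc n) → ℕ) i j → j < pendants (suc n) a i →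
                     deg (caterpillar (suc n) a) (pd i j) ≡ 1
deg-caterpillar-pd {n} a i j j<p =
  trans (deg-++ (pathEdges (suc n)) (pendantEdges (suc n) a) (pd i j))
        (cong₂ _+_ (deg-pathEdges-pd i j) (deg-pendantEdges-pd a i j j<p))

variation : ∀ {n} → (Fin (suc n) → ℕ) → ℕ
variation {n} x = ∑[ k < n ] ∣ x (inject₁ k) - x (suc k) ∣

irr-caterpillar : ∀ {n} (a : Fin (suc n) → ℕ) → (∀ i → backboneNbrs (suc n) i ≤ a i) →
                  irr (caterpillar (suc n) a) ≡ variation a + ∑[ i < suc n ] (pendants (suc n) a i * ∣ a i - 1 ∣)
irr-caterpillar {n} a nbrs≤a = begin
  irr G                                                             ≡⟨ sum-map-++ w (pathEdges (suc n)) (pendantEdges (suc n) a) ⟩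
  sum (map w (pathEdges (suc n))) + sum (map w (pendantEdges (suc n) a)) ≡⟨ cong₂ _+_ (sum-pathEdges w) (sum-pendantEdges a w) ⟩
  ∑[ k < n ] w (bb (inject₁ k) , bb (suc k)) + ∑[ i < suc n ] ∑[ j < pendants (suc n) a i ] w (bb i , pd i (toℕ j))
    ≡⟨ cong₂ _+_ (sum-cong-≗ path-edge) (sum-cong-≗ leaf-edges) ⟩
  variation a + ∑[ i < suc n ] (pendants (suc n) a i * ∣ a i - 1 ∣)  ∎
  where
  open ≡-Reasoning
  G : Graph (suc n)
  G = caterpillar (suc n) a
  w : V (suc n) × V (suc n) → ℕ
  w (u , v) = ∣ deg G u - deg G v ∣
  path-edge : ∀ k → w (bb (inject₁ k) , bb (suc k)) ≡ ∣ a (inject₁ k) - a (suc k) ∣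
  path-edge k = cong₂ ∣_-_∣ (deg-caterpillar-bb a nbrs≤a (inject₁ k)) (deg-caterpillar-bb a nbrs≤a (suc k))
  leaf-edges : ∀ i → ∑[ j < pendants (suc n) a i ] w (bb i , pd i (toℕ j)) ≡ pendants (suc n) a i * ∣ a i - 1 ∣
  leaf-edges i = trans (sum-cong-≗ λ j → cong₂ ∣_-_∣ (deg-caterpillar-bb a nbrs≤a i) (deg-caterpillar-pd a i (toℕ j) (Finₚ.toℕ<n j)))
                       (∑-const (pendants (suc n) a i) ∣ a i - 1 ∣)

closedVariation : ∀ {n} → (Fin (suc n) → ℕ) → ℕ
closedVariation {n} x = x zero + variation x + x (fromℕ n)

irr-caterpillar-closedVariation :
  ∀ {n} (a : Fin (suc n) → ℕ) → (∀ i → 0 < a i) → (∀ i → backboneNbrs (suc n) i ≤ a i) →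
  irr (caterpillar (suc n) a) + 2 * suc (∑[ i < suc n ] (a i ∸ 1)) ≡ closedVariation a + ∑[ i < suc n ] (a i * (a i ∸ 1))
irr-caterpillar-closedVariation {n} a 0<a nbrs≤a = begin
  irr (caterpillar (suc n) a) + 2 * suc Σe              ≡⟨ cong (_+ 2 * suc Σe) irr≡var+Σke ⟩
  var + Σke + 2 * suc Σe                                ≡⟨ double var Σke Σe ⟩
  var + Σke + (Σe + Σe) + 2                             ≡⟨ cong (λ t → var + Σke + t + 2) (∑-backboneNbrs e) ⟨
  var + Σke + (Σbe + e zero + e (fromℕ n)) + 2          ≡⟨ regroup var Σke Σbe (e zero) (e (fromℕ n)) ⟩
  (e zero + 1) + var + (e (fromℕ n) + 1) + (Σke + Σbe)  ≡⟨ cong₂ _+_ (cong₂ _+_ (cong (_+ var) (m∸n+n≡m (0<a zero)))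
                                                                              (m∸n+n≡m (0<a (fromℕ n))))
                                                                   Σke+Σbe≡∑ae ⟩
  closedVariation a + ∑[ i < suc n ] (a i * e i)        ∎
  where
  open ≡-Reasoning
  e : Fin (suc n) → ℕ
  e i = a i ∸ 1
  Σe var Σke Σbe : ℕ
  Σe = ∑[ i < suc n ] e i
  var = variation a
  Σke = ∑[ i < suc n ] (pendants (suc n) a i * e i)
  Σbe = ∑[ i < suc n ] (backboneNbrs (suc n) i * e i)
  irr≡var+Σke : irr (caterpillar (suc n) a) ≡ var + Σke
  irr≡var+Σke = trans (irr-caterpillar a nbrs≤a)
                      (cong (var +_) (sum-cong-≗ λ i → cong (pendants (suc n) a i *_) (m≤n⇒∣n-m∣≡n∸m (0<a i))))
  Σke+Σbe≡∑ae : Σke + Σbe ≡ ∑[ i < suc n ] (a i * e i)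
  Σke+Σbe≡∑ae = trans (sym (∑-distrib-+ (λ i → pendants (suc n) a i * e i) (λ i → backboneNbrs (suc n) i * e i)))
                      (sum-cong-≗ λ i → trans (sym (*-distribʳ-+ (e i) (pendants (suc n) a i) (backboneNbrs (suc n) i)))
                                              (cong (_* e i) (m∸n+n≡m (nbrs≤a i))))
  double : ∀ v k s → v + k + 2 * suc s ≡ v + k + (s + s) + 2
  double = solve-∀
  regroup : ∀ v k b x y → v + k + (b + x + y) + 2 ≡ (x + 1) + v + (y + 1) + (k + b)
  regroup = solve-∀

head≤variation+last : ∀ {n} (x : Fin (suc n) → ℕ) → x zero ≤ variation x + x (fromℕ n)
head≤variation+last {zero}  x = ≤-refl
head≤variation+last {suc n} x = begin
  x zero                                                   ≤⟨ m≤∣m-n∣+n (x zero) (x (suc zero)) ⟩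
  ∣ x zero - x (suc zero) ∣ + x (suc zero)                 ≤⟨ +-monoʳ-≤ ∣ x zero - x (suc zero) ∣ (head≤variation+last (x ∘ suc)) ⟩
  ∣ x zero - x (suc zero) ∣ + (variation (x ∘ suc) + x (fromℕ (suc n))) ≡⟨ +-assoc ∣ x zero - x (suc zero) ∣ _ _ ⟨
  variation x + x (fromℕ (suc n))                          ∎
  where open ≤-Reasoning

twice≤closedVariation : ∀ {n} (x : Fin (suc n) → ℕ) p → x p + x p ≤ closedVariation x
twice≤closedVariation x zero = begin
  x zero + x zero                                  ≤⟨ +-monoʳ-≤ (x zero) (head≤variation+last x) ⟩
  x zero + (variation x + x (fromℕ _))             ≡⟨ +-assoc (x zero) (variation x) _ ⟨
  closedVariation x                                ∎
  where open ≤-Reasoning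
twice≤closedVariation {suc n} x (suc p) = begin
  x (suc p) + x (suc p)                                              ≤⟨ twice≤closedVariation (x ∘ suc) p ⟩
  x (suc zero) + variation (x ∘ suc) + x (fromℕ (suc n))             ≤⟨ +-monoˡ-≤ _ (+-monoˡ-≤ _ (m≤n+∣n-m∣ (x (suc zero)) (x zero))) ⟩
  x zero + ∣ x zero - x (suc zero) ∣ + variation (x ∘ suc) + x (fromℕ (suc n)) ≡⟨ cong (_+ x (fromℕ (suc n))) (+-assoc (x zero) ∣ x zero - x (suc zero) ∣ (variation (x ∘ suc))) ⟩
  closedVariation x                                                  ∎
  where open ≤-Reasoning

head+variation-monotone : ∀ {n} (x : Fin (suc n) → ℕ) → (∀ k → x (inject₁ k) ≤ x (suc k)) →
                          x zero + variation x ≡ x (fromℕ n)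
head+variation-monotone {zero}  x mono = +-identityʳ (x zero)
head+variation-monotone {suc n} x mono = begin
  x zero + (∣ x zero - x (suc zero) ∣ + variation (x ∘ suc)) ≡⟨ +-assoc (x zero) ∣ x zero - x (suc zero) ∣ _ ⟨
  x zero + ∣ x zero - x (suc zero) ∣ + variation (x ∘ suc)   ≡⟨ cong (_+ variation (x ∘ suc)) step ⟩
  x (suc zero) + variation (x ∘ suc)                         ≡⟨ head+variation-monotone (x ∘ suc) (mono ∘ suc) ⟩
  x (fromℕ (suc n))                                          ∎
  where
  open ≡-Reasoning
  step : x zero + ∣ x zero - x (suc zero) ∣ ≡ x (suc zero)
  step = trans (cong (x zero +_) (m≤n⇒∣m-n∣≡n∸m (mono zero))) (m+[n∸m]≡n (mono zero))

closedVariation-monotone : ∀ {n} (x : Fin (suc n) → ℕ) → (∀ k → x (inject₁ k) ≤ x (suc k)) →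
                           closedVariation x ≡ x (fromℕ n) + x (fromℕ n)
closedVariation-monotone {n} x mono = cong (_+ x (fromℕ n)) (head+variation-monotone x mono)

mainTheorem1 : (n : ℕ) → 3 ≤ n → (d : Fin n → ℕ) → (∀ i → 0 < d i)
    → (∀ i j → i Fin.< j → d i < d j)
    → (σ : Permutation′ n)
    → (∀ i → backboneNbrs n i ≤ d (σ ⟨$⟩ʳ i))
    → irr (caterpillar n d) ≤ irr (caterpillar n (λ i → d (σ ⟨$⟩ʳ i)))
mainTheorem1 zero    () d 0<d d↑ σ nbrs≤dσ
mainTheorem1 (suc n) _  d 0<d d↑ σ nbrs≤dσ = +-cancelʳ-≤ (2 * suc (∑[ i < suc n ] (d i ∸ 1))) _ _ (begin
  irr (caterpillar (suc n) d) + 2 * suc (∑[ i < suc n ] (d i ∸ 1))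
    ≡⟨ irr-caterpillar-closedVariation d 0<d (increasing⇒nbrs≤ d 0<d d↑) ⟩
  closedVariation d + F d          ≡⟨ cong (_+ F d) (closedVariation-monotone d (λ k → <⇒≤ (d↑ _ _ (Finₚ.≤̄⇒inject₁< ≤-refl)))) ⟩
  d top + d top + F d              ≡⟨ cong (λ t → t + t + F d) (cong d (inverseʳ σ)) ⟨
  dσ p + dσ p + F d                ≤⟨ +-monoˡ-≤ (F d) (twice≤closedVariation dσ p) ⟩
  closedVariation dσ + F d         ≡⟨ cong (closedVariation dσ +_) (sum-permute (λ i → d i * (d i ∸ 1)) σ) ⟩
  closedVariation dσ + F dσ        ≡⟨ irr-caterpillar-closedVariation dσ (0<d ∘ (σ ⟨$⟩ʳ_)) nbrs≤dσ ⟨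
  irr (caterpillar (suc n) dσ) + 2 * suc (∑[ i < suc n ] (dσ i ∸ 1))
    ≡⟨ cong (λ s → irr (caterpillar (suc n) dσ) + 2 * suc s) (sum-permute (λ i → d i ∸ 1) σ) ⟨
  irr (caterpillar (suc n) dσ) + 2 * suc (∑[ i < suc n ] (d i ∸ 1)) ∎)
  where
  open ≤-Reasoning
  dσ : Fin (suc n) → ℕ
  dσ i = d (σ ⟨$⟩ʳ i)
  F : (Fin (suc n) → ℕ) → ℕ
  F a = ∑[ i < suc n ] (a i * (a i ∸ 1))
  top p : Fin (suc n)
  top = fromℕ n
  p = σ ⟨$⟩ˡ top
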